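{- Let $\mathcal{D}$ be a lazy derivation of $\mathsf{LEM}$ that contains at least one instance of cut and all of whose instances of cut are exponential cuts. Then at least one of those cuts is safe.
   Context: $\mathsf{LEM}$: linear types $A ::= \alpha \mid \sigma\multimap A \mid \forall\alpha.A$; types $\sigma ::= A \mid \S\sigma$, where in $\S\sigma$ the type $\sigma$ is closed with no negative occurrence of $\forall$ (standard polarity: inside $\sigma$ in $\sigma\multimap A$ polarity reverses; $\forall$, $\S$ preserve it). Values are closed $\beta$-normal linear $\lambda$-terms. Terms: $x\mid\lambda x.M\mid MN\mid\mathtt{discard}_\sigma\,M\ \mathtt{in}\ N\mid\mathtt{copy}^V_\sigma\,M\ \mathtt{as}\ x,y\ \mathtt{in}\ N$ ($V$ a value), linear only. Typing rules: (ax) $x:A\vdash x:A$, $A$ linear; (cut) from $\Gamma\vdash N:\sigma$, $\Delta,x:\sigma\vdash M:\tau$ infer $\Gamma,\Delta\vdash M[N/x]:\tau$; ($\multimap$R) from $\Gamma,x:\sigma\vdash M:B$ infer $\Gamma\vdash\lambda x.M:\sigma\multimap B$; ($\multimap$L) from $\Gamma\vdash N:\sigma$, $\Delta,x:B\vdash M:\tau$ infer $\Gamma,\Delta,y:\sigma\multimap B\vdash M[yN/x]:\tau$; ($\forall$R) from $\Gamma\vdash M:A\langle\gamma/\alpha\rangle$, $\gamma$ not free in $\Gamma$, infer $\Gamma\vdash M:\forall\alpha.A$; ($\forall$L) from $\Gamma,x:A\langle B/\alpha\rangle\vdash M:\tau$ infer $\Gamma,x:\forall\alpha.A\vdash M:\tau$;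 ($p$) from $x_1:\S\sigma_1,\dots,x_n:\S\sigma_n\vdash M:\sigma$ infer the same context $\vdash M:\S\sigma$; ($d$) from $\Gamma,x:\sigma\vdash M:\tau$ infer $\Gamma,y:\S\sigma\vdash M[y/x]:\tau$; ($w$) from $\Gamma\vdash M:\tau$ infer $\Gamma,x:\S\sigma\vdash\mathtt{discard}_\sigma\,x\ \mathtt{in}\ M:\tau$; ($c$) from $\Gamma,y:\S\sigma,z:\S\sigma\vdash M:\tau$ and $\vdash V:\sigma$ infer $\Gamma,x:\S\sigma\vdash\mathtt{copy}^V_\sigma\,x\ \mathtt{as}\ y,z\ \mathtt{in}\ M:\tau$. Lazy type: no negative occurrence of $\forall$. Lazy judgment $x_1:\sigma_1,\dots,x_n:\sigma_n\vdash M:\tau$: $\tau$ lazy and no $\sigma_i$ has a positive occurrence of $\forall$; lazy derivation: its conclusion is lazy. An exponential cut is an instance of cut (from $\Gamma\vdash N:\sigma$ and $\Delta,x:\sigma\vdash M:\tau$) whose left premise is concluded by $p$ and whose right premise is concluded by $d$, $w$ or $c$ (introducing the cut formula). An exponential cut is safe if $\Gamma$ is empty, and is a deadlock otherwise. -}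

module Defs where

open import Data.Nat using (ℕ; zero; suc; _<_; _≡ᵇ_)
open import Data.Bool using (Bool; true; false; if_then_else_; _∨_)
open import Data.List using (List; []; _∷_; _++_; map)
open import Data.List.Relation.Unary.All using (All)
open import Data.List.Relation.Unary.Unique.Propositional using (Unique)
open import Data.List.Relation.Binary.Permutation.Propositional using (_↭_)
open import Data.List.Membership.Propositional using (_∉_)
open import Data.Product using (_×_; _,_; proj₁; proj₂; ∃)
open import Data.Sum using (_⊎_)
open import Data.Unit using (⊤)
open import Data.Empty using (⊥)
open import Relation.Binary.PropositionalEquality using (_≡_)

-- Types of LEM (locally nameless: free type variables are named by ℕ,
-- variables bound by ∀ are de Bruijn indices).
--   linear types  A ::= α | σ ⊸ A | ∀α.A
--   types         σ ::= A | §σ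

mutual
  data LTy : Set where
    tfv : ℕ → LTy
    tbv : ℕ → LTy
    _⊸_ : Ty → LTy → LTy
    Π   : LTy → LTy          -- ∀α.A, body uses index 0 for α

  data Ty : Set where
    ⌊_⌋ : LTy → Ty
    §_  : Ty → Ty

infixr 5 _⊸_

mutual
  fvsL : LTy → List ℕ
  fvsL (tfv a) = a ∷ []
  fvsL (tbv _) = []
  fvsL (σ ⊸ A) = fvsT σ ++ fvsL A
  fvsL (Π A)   = fvsL A

  fvsT : Ty → List ℕ
  fvsT ⌊ A ⌋ = fvsL A
  fvsT (§ σ) = fvsT σ

mutual
  openL : ℕ → LTy → LTy → LTy
  openL k B (tfv a) = tfv a
  openL k B (tbv i) = if i ≡ᵇ k then B else tbv i
  openL k B (σ ⊸ A) = openT k B σ ⊸ openL k B A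
  openL k B (Π A)   = Π (openL (suc k) B A)

  openT : ℕ → LTy → Ty → Ty
  openT k B ⌊ A ⌋ = ⌊ openL k B A ⌋
  openT k B (§ σ) = § openT k B σ

-- polarity of ∀: NoNeg σ = "no negative occurrence of ∀ in σ",
-- NoPos σ = "no positive occurrence of ∀ in σ"
mutual
  NoNegL : LTy → Set
  NoNegL (tfv _) = ⊤
  NoNegL (tbv _) = ⊤
  NoNegL (σ ⊸ A) = NoPosT σ × NoNegL A
  NoNegL (Π A)   = NoNegL A

  NoPosL : LTy → Set
  NoPosL (tfv _) = ⊤
  NoPosL (tbv _) = ⊤
  NoPosL (σ ⊸ A) = NoNegT σ × NoPosL A
  NoPosL (Π A)   = ⊥

  NoNegT : Ty → Set
  NoNegT ⌊ A ⌋ = NoNegL A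
  NoNegT (§ σ) = NoNegT σ

  NoPosT : Ty → Set
  NoPosT ⌊ A ⌋ = NoPosL A
  NoPosT (§ σ) = NoPosT σ

mutual
  WFL : ℕ → LTy → Set
  WFL k (tfv _) = ⊤
  WFL k (tbv i) = i < k
  WFL k (σ ⊸ A) = WFT k σ × WFL k A
  WFL k (Π A)   = WFL (suc k) A

  WFT : ℕ → Ty → Set
  WFT k ⌊ A ⌋ = WFL k A
  WFT k (§ σ) = WFT 0 σ × fvsT σ ≡ [] × NoNegT σ

LazyTy : Ty → Set
LazyTy = NoNegT

Var : Set
Var = ℕ

data Term : Set where
  var     : Var → Term
  lam     : Var → Term → Term
  app     : Term → Term → Term
  discard : Ty → Term → Term → Term                     -- discard_σ M in N
  copy    : Term → Ty → Term → Var → Var → Term → Term  -- copy^V_σ M as x,y in N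

_[_/_] : Term → Term → Var → Term
var y [ N / x ] = if y ≡ᵇ x then N else var y
lam y M [ N / x ] = if y ≡ᵇ x then lam y M else lam y (M [ N / x ])
app M₁ M₂ [ N / x ] = app (M₁ [ N / x ]) (M₂ [ N / x ])
discard σ M₁ M₂ [ N / x ] = discard σ (M₁ [ N / x ]) (M₂ [ N / x ])
copy V σ M₁ y z M₂ [ N / x ] =
  copy V σ (M₁ [ N / x ]) y z (if (y ≡ᵇ x) ∨ (z ≡ᵇ x) then M₂ else M₂ [ N / x ])

occ : Var → Term → ℕ
occ x (var y) = if y ≡ᵇ x then 1 else 0
occ x (lam y M) = if y ≡ᵇ x then 0 else occ x M
occ x (app M N) = occ x M Data.Nat.+ occ x N
occ x (discard _ M N) = occ x M Data.Nat.+ occ x N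
occ x (copy _ _ M y z N) =
  occ x M Data.Nat.+ (if (y ≡ᵇ x) ∨ (z ≡ᵇ x) then 0 else occ x N)

Pure : Term → Set
Pure (var _) = ⊤
Pure (lam _ M) = Pure M
Pure (app M N) = Pure M × Pure N
Pure (discard _ _ _) = ⊥
Pure (copy _ _ _ _ _ _) = ⊥

Normal : Term → Set
Normal (var _) = ⊤
Normal (lam _ M) = Normal M
Normal (app (lam _ _) _) = ⊥
Normal (app M N) = Normal M × Normal N
Normal (discard _ M N) = Normal M × Normal N
Normal (copy _ _ M _ _ N) = Normal M × Normal N

LinearTm : Term → Set
LinearTm (var _) = ⊤
LinearTm (lam x M) = occ x M ≡ 1 × LinearTm M
LinearTm (app M N) = LinearTm M × LinearTm N
LinearTm (discard _ M N) = LinearTm M × LinearTm N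
LinearTm (copy _ _ M _ _ N) = LinearTm M × LinearTm N

Closed : Term → Set
Closed M = (x : Var) → occ x M ≡ 0

IsValue : Term → Set
IsValue V = Pure V × Closed V × Normal V × LinearTm V

Ctx : Set
Ctx = List (Var × Ty)

Distinct : Ctx → Set
Distinct Γ = Unique (map proj₁ Γ)

NotFreeIn : ℕ → Ctx → Set
NotFreeIn γ Γ = All (λ p → γ ∉ fvsT (proj₂ p)) Γ

AllBang : Ctx → Set
AllBang Γ = All (λ p → ∃ λ σ → proj₂ p ≡ § σ) Γ

-- Contexts are lists; rules that combine/extend contexts allow the
-- conclusion context Θ to be any permutation (contexts are multisets).
infix 4 _⊢_∶_
data _⊢_∶_ : Ctx → Term → Ty → Set where
  ax   : ∀ {x A} → WFL 0 A → ((x , ⌊ A ⌋) ∷ []) ⊢ var x ∶ ⌊ A ⌋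
  cut  : ∀ {Γ Δ Θ N M σ τ} (x : Var) →
         Γ ⊢ N ∶ σ → ((x , σ) ∷ Δ) ⊢ M ∶ τ →
         Θ ↭ Γ ++ Δ → Distinct Θ →
         Θ ⊢ M [ N / x ] ∶ τ
  ⊸R   : ∀ {Γ x M σ B} →
         ((x , σ) ∷ Γ) ⊢ M ∶ ⌊ B ⌋ →
         Γ ⊢ lam x M ∶ ⌊ σ ⊸ B ⌋
  ⊸L   : ∀ {Γ Δ Θ N M x σ B τ} (y : Var) →
         Γ ⊢ N ∶ σ → ((x , ⌊ B ⌋) ∷ Δ) ⊢ M ∶ τ →
         Θ ↭ (y , ⌊ σ ⊸ B ⌋) ∷ Γ ++ Δ → Distinct Θ →
         Θ ⊢ M [ app (var y) N / x ] ∶ τ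
  ∀R   : ∀ {Γ M A} (γ : ℕ) → WFL 0 (Π A) →
         Γ ⊢ M ∶ ⌊ openL 0 (tfv γ) A ⌋ → NotFreeIn γ Γ →
         Γ ⊢ M ∶ ⌊ Π A ⌋
  ∀L   : ∀ {Γ Θ x A M τ} (B : LTy) → WFL 0 (Π A) → WFL 0 B →
         ((x , ⌊ openL 0 B A ⌋) ∷ Γ) ⊢ M ∶ τ →
         Θ ↭ (x , ⌊ Π A ⌋) ∷ Γ → Distinct Θ →
         Θ ⊢ M ∶ τ
  p    : ∀ {Γ M σ} → WFT 0 (§ σ) → AllBang Γ →
         Γ ⊢ M ∶ σ →
         Γ ⊢ M ∶ § σ
  d    : ∀ {Γ Θ x M σ τ} (y : Var) → WFT 0 (§ σ) →
         ((x , σ) ∷ Γ) ⊢ M ∶ τ →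
         Θ ↭ (y , § σ) ∷ Γ → Distinct Θ →
         Θ ⊢ M [ var y / x ] ∶ τ
  w    : ∀ {Γ Θ M σ τ} (x : Var) → WFT 0 (§ σ) →
         Γ ⊢ M ∶ τ →
         Θ ↭ (x , § σ) ∷ Γ → Distinct Θ →
         Θ ⊢ discard σ (var x) M ∶ τ
  c    : ∀ {Γ Θ y z M V σ τ} (x : Var) → WFT 0 (§ σ) →
         ((y , § σ) ∷ (z , § σ) ∷ Γ) ⊢ M ∶ τ →
         [] ⊢ V ∶ σ → IsValue V →
         Θ ↭ (x , § σ) ∷ Γ → Distinct Θ →
         Θ ⊢ copy V σ (var x) y z M ∶ τ

LazyJudgment : Ctx → Ty → Set
LazyJudgment Γ τ = LazyTy τ × All (λ q → NoPosT (proj₂ q)) Γ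

LazyDerivation : ∀ {Γ M τ} → Γ ⊢ M ∶ τ → Set
LazyDerivation {Γ} {M} {τ} _ = LazyJudgment Γ τ

CutPred : Set₁
CutPred = ∀ {Γ Δ N M σ τ} (x : Var) → Γ ⊢ N ∶ σ → ((x , σ) ∷ Δ) ⊢ M ∶ τ → Set

AnyCut : CutPred → ∀ {Γ M τ} → Γ ⊢ M ∶ τ → Set
AnyCut P (ax _) = ⊥
AnyCut P (cut x D₁ D₂ _ _) = P x D₁ D₂ ⊎ AnyCut P D₁ ⊎ AnyCut P D₂
AnyCut P (⊸R D) = AnyCut P D
AnyCut P (⊸L _ D₁ D₂ _ _) = AnyCut P D₁ ⊎ AnyCut P D₂
AnyCut P (∀R _ _ D _) = AnyCut P D
AnyCut P (∀L _ _ _ D _ _) = AnyCut P D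
AnyCut P (p _ _ D) = AnyCut P D
AnyCut P (d _ _ D _ _) = AnyCut P D
AnyCut P (w _ _ D _ _) = AnyCut P D
AnyCut P (c _ _ D Dv _ _ _) = AnyCut P D ⊎ AnyCut P Dv

AllCuts : CutPred → ∀ {Γ M τ} → Γ ⊢ M ∶ τ → Set
AllCuts P (ax _) = ⊤
AllCuts P (cut x D₁ D₂ _ _) = P x D₁ D₂ × AllCuts P D₁ × AllCuts P D₂
AllCuts P (⊸R D) = AllCuts P D
AllCuts P (⊸L _ D₁ D₂ _ _) = AllCuts P D₁ × AllCuts P D₂
AllCuts P (∀R _ _ D _) = AllCuts P D
AllCuts P (∀L _ _ _ D _ _) = AllCuts P D
AllCuts P (p _ _ D) = AllCuts P D
AllCuts P (d _ _ D _ _) = AllCuts P D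
AllCuts P (w _ _ D _ _) = AllCuts P D
AllCuts P (c _ _ D Dv _ _ _) = AllCuts P D × AllCuts P Dv

ContainsCut : ∀ {Γ M τ} → Γ ⊢ M ∶ τ → Set
ContainsCut = AnyCut (λ _ _ _ → ⊤)

EndsWithP : ∀ {Γ M τ} → Γ ⊢ M ∶ τ → Set
EndsWithP (p _ _ _) = ⊤
EndsWithP _ = ⊥

IntroducesBy-dwc : Var → ∀ {Γ M τ} → Γ ⊢ M ∶ τ → Set
IntroducesBy-dwc x (d y _ _ _ _) = y ≡ x
IntroducesBy-dwc x (w y _ _ _ _) = y ≡ x
IntroducesBy-dwc x (c y _ _ _ _ _ _) = y ≡ x
IntroducesBy-dwc x _ = ⊥

ExponentialCut : CutPred
ExponentialCut x D₁ D₂ = EndsWithP D₁ × IntroducesBy-dwc x D₂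

SafeCut : CutPred
SafeCut {Γ} x D₁ D₂ = ExponentialCut x D₁ D₂ × Γ ≡ []

-- In a lazy judgment no hypothesis has a positive ∀. A closed type, however, always
-- has one: its rightmost atom is a bound variable, and the ∀ binding it lies on the
-- positive spine. Hence the context of a p rule, all of whose hypotheses are closed
-- §-types, is empty as soon as it is part of a lazy context. Laziness propagates
-- from a conclusion to the premises of every rule except cut (a lazy ∀L is
-- impossible, and ∀R opens with a ∀-free eigenvariable), so the lowest cut of D sits
-- in a lazy judgment; being exponential, its left premise ends with p, so it is safe.
module Submission where

open import Defs
open import Data.List using ([])
open import Data.List.Properties using (++-conicalʳ)
open import Data.List.Relation.Unary.All using (All; []; _∷_)
open import Data.List.Relation.Unary.All.Properties using (++⁺; ++⁻ˡ; ++⁻ʳ)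
open import Data.List.Relation.Binary.Permutation.Propositional using (↭-sym)
open import Data.List.Relation.Binary.Permutation.Propositional.Properties using (All-resp-↭)
open import Data.Nat using (suc; _<_; _≡ᵇ_; s≤s; z≤n)
open import Data.Bool using (true; false)
open import Data.Product using (_×_; _,_; proj₁; proj₂)
open import Data.Sum using (inj₁) renaming (map to ⊎-map)
open import Data.Unit using (tt)
open import Relation.Nullary using (¬_)
open import Relation.Binary.PropositionalEquality using (_≡_; refl)

WFCtx : Ctx → Set
WFCtx = All (λ q → WFT 0 (proj₂ q))

NoPosCtx : Ctx → Set
NoPosCtx = All (λ q → NoPosT (proj₂ q))

mutual
  closedL-noPos⇒0<k : ∀ k A → WFL k A → fvsL A ≡ [] → NoPosL A → 0 < k
  closedL-noPos⇒0<k k       (tfv _) _          ()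
  closedL-noPos⇒0<k (suc k) (tbv _) _          _  _        = s≤s z≤n
  closedL-noPos⇒0<k k       (σ ⊸ A) (_ , wfA) fv (_ , nA) =
    closedL-noPos⇒0<k k A wfA (++-conicalʳ (fvsT σ) (fvsL A) fv) nA

  closedT-noPos⇒0<k : ∀ k σ → WFT k σ → fvsT σ ≡ [] → NoPosT σ → 0 < k
  closedT-noPos⇒0<k k ⌊ A ⌋ wf fv n = closedL-noPos⇒0<k k A wf fv n
  closedT-noPos⇒0<k k (§ σ) (wf , fv , _) _ n with closedT-noPos⇒0<k 0 σ wf fv n
  ... | ()

wf-§⇒¬NoPos : ∀ {σ} → WFT 0 (§ σ) → ¬ NoPosT σ
wf-§⇒¬NoPos {σ} (wf , fv , _) n with closedT-noPos⇒0<k 0 σ wf fv n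
... | ()

bang-noPos-ctx≡[] : ∀ {Γ} → AllBang Γ → WFCtx Γ → NoPosCtx Γ → Γ ≡ []
bang-noPos-ctx≡[] []               _        _       = refl
bang-noPos-ctx≡[] ((σ , refl) ∷ _) (wf ∷ _) (n ∷ _) with wf-§⇒¬NoPos {σ} wf n
... | ()

⊢-wf : ∀ {Γ M τ} → Γ ⊢ M ∶ τ → WFCtx Γ × WFT 0 τ
⊢-wf (ax wf) = wf ∷ [] , wf
⊢-wf (cut _ D₁ D₂ π _) with ⊢-wf D₁ | ⊢-wf D₂
... | wfΓ , _ | _ ∷ wfΔ , wfτ = All-resp-↭ (↭-sym π) (++⁺ wfΓ wfΔ) , wfτ
⊢-wf (⊸R D) with ⊢-wf D
... | wfσ ∷ wfΓ , wfB = wfΓ , (wfσ , wfB)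
⊢-wf (⊸L _ D₁ D₂ π _) with ⊢-wf D₁ | ⊢-wf D₂
... | wfΓ , wfσ | wfB ∷ wfΔ , wfτ = All-resp-↭ (↭-sym π) ((wfσ , wfB) ∷ ++⁺ wfΓ wfΔ) , wfτ
⊢-wf (∀R _ wf D _) = proj₁ (⊢-wf D) , wf
⊢-wf (∀L _ wf _ D π _) with ⊢-wf D
... | _ ∷ wfΓ , wfτ = All-resp-↭ (↭-sym π) (wf ∷ wfΓ) , wfτ
⊢-wf (p wf _ D) = proj₁ (⊢-wf D) , wf
⊢-wf (d _ wf D π _) with ⊢-wf D
... | _ ∷ wfΓ , wfτ = All-resp-↭ (↭-sym π) (wf ∷ wfΓ) , wfτ
⊢-wf (w _ wf D π _) with ⊢-wf D
... | wfΓ , wfτ = All-resp-↭ (↭-sym π) (wf ∷ wfΓ) , wfτ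
⊢-wf (c _ wf D _ _ π _) with ⊢-wf D
... | _ ∷ _ ∷ wfΓ , wfτ = All-resp-↭ (↭-sym π) (wf ∷ wfΓ) , wfτ

EndsWithP⇒AllBang : ∀ {Γ M τ} (D : Γ ⊢ M ∶ τ) → EndsWithP D → AllBang Γ
EndsWithP⇒AllBang (p _ bang _) _ = bang

EndsWithP-noPos-ctx≡[] : ∀ {Γ M τ} (D : Γ ⊢ M ∶ τ) → EndsWithP D → NoPosCtx Γ → Γ ≡ []
EndsWithP-noPos-ctx≡[] D ends = bang-noPos-ctx≡[] (EndsWithP⇒AllBang D ends) (proj₁ (⊢-wf D))

mutual
  openL-NoNeg : ∀ k B A → NoNegL B → NoPosL B → NoNegL A → NoNegL (openL k B A)
  openL-NoNeg k B (tfv _) _  _  _ = tt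
  openL-NoNeg k B (tbv i) nB _  _ with i ≡ᵇ k
  ... | true  = nB
  ... | false = tt
  openL-NoNeg k B (σ ⊸ A) nB pB (nσ , nA) = openT-NoPos k B σ nB pB nσ , openL-NoNeg k B A nB pB nA
  openL-NoNeg k B (Π A)   nB pB nA       = openL-NoNeg (suc k) B A nB pB nA

  openL-NoPos : ∀ k B A → NoNegL B → NoPosL B → NoPosL A → NoPosL (openL k B A)
  openL-NoPos k B (tfv _) _  _  _ = tt
  openL-NoPos k B (tbv i) _  pB _ with i ≡ᵇ k
  ... | true  = pB
  ... | false = tt
  openL-NoPos k B (σ ⊸ A) nB pB (nσ , pA) = openT-NoNeg k B σ nB pB nσ , openL-NoPos k B A nB pB pA

  openT-NoNeg : ∀ k B σ → NoNegL B → NoPosL B → NoNegT σ → NoNegT (openT k B σ)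
  openT-NoNeg k B ⌊ A ⌋ = openL-NoNeg k B A
  openT-NoNeg k B (§ σ) = openT-NoNeg k B σ

  openT-NoPos : ∀ k B σ → NoNegL B → NoPosL B → NoPosT σ → NoPosT (openT k B σ)
  openT-NoPos k B ⌊ A ⌋ = openL-NoPos k B A
  openT-NoPos k B (§ σ) = openT-NoPos k B σ

lazy-exponential-cuts⇒safe-cut : ∀ {Γ M τ} (D : Γ ⊢ M ∶ τ) → LazyJudgment Γ τ →
  ContainsCut D → AllCuts ExponentialCut D → AnyCut SafeCut D
lazy-exponential-cuts⇒safe-cut (cut _ D₁ _ π _) (_ , nΘ) _ (exp@(ends , _) , _) =
  inj₁ (exp , EndsWithP-noPos-ctx≡[] D₁ ends (++⁻ˡ _ (All-resp-↭ π nΘ)))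
lazy-exponential-cuts⇒safe-cut (⊸R D) ((pσ , nB) , nΓ) =
  lazy-exponential-cuts⇒safe-cut D (nB , pσ ∷ nΓ)
lazy-exponential-cuts⇒safe-cut (⊸L {Γ = Γ} _ D₁ D₂ π _) (nτ , nΘ) cc (a₁ , a₂)
  with All-resp-↭ π nΘ
... | (nσ , pB) ∷ nΓΔ =
  ⊎-map (λ k → lazy-exponential-cuts⇒safe-cut D₁ (nσ , ++⁻ˡ Γ nΓΔ) k a₁)
        (λ k → lazy-exponential-cuts⇒safe-cut D₂ (nτ , pB ∷ ++⁻ʳ Γ nΓΔ) k a₂) cc
lazy-exponential-cuts⇒safe-cut (∀R {A = A} γ _ D _) (nτ , nΓ) =
  lazy-exponential-cuts⇒safe-cut D (openL-NoNeg 0 (tfv γ) A tt tt nτ , nΓ)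
lazy-exponential-cuts⇒safe-cut (∀L _ _ _ _ π _) (_ , nΘ) _ _ with All-resp-↭ π nΘ
... | () ∷ _
lazy-exponential-cuts⇒safe-cut (p _ _ D) = lazy-exponential-cuts⇒safe-cut D
lazy-exponential-cuts⇒safe-cut (d _ _ D π _) (nτ , nΘ) with All-resp-↭ π nΘ
... | pσ ∷ nΓ = lazy-exponential-cuts⇒safe-cut D (nτ , pσ ∷ nΓ)
lazy-exponential-cuts⇒safe-cut (w _ _ D π _) (nτ , nΘ) with All-resp-↭ π nΘ
... | _ ∷ nΓ = lazy-exponential-cuts⇒safe-cut D (nτ , nΓ)
lazy-exponential-cuts⇒safe-cut (c _ (_ , _ , nσ) D Dv _ π _) (nτ , nΘ) cc (a , av)
  with All-resp-↭ π nΘ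
... | pσ ∷ nΓ =
  ⊎-map (λ k → lazy-exponential-cuts⇒safe-cut D (nτ , pσ ∷ pσ ∷ nΓ) k a)
        (λ k → lazy-exponential-cuts⇒safe-cut Dv (nσ , []) k av) cc

lemma5p9 : ∀ {Γ M τ} (D : Γ ⊢ M ∶ τ) →
    LazyDerivation D →
    ContainsCut D →
    AllCuts ExponentialCut D →
    AnyCut SafeCut D
lemma5p9 = lazy-exponential-cuts⇒safe-cut
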